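{- For contexts $\Gamma_1,\Delta_1,\Gamma_2,\Delta_2$: if $\langle\Gamma_1\,|\,[\Delta_1]\rangle \le^a \langle\Gamma_2\,|\,[\Delta_2]\rangle$, then $\langle\Gamma_1\,|\,[\Delta_1]\rangle \le^s \langle\Gamma_2\,|\,[\Delta_2]\rangle$.
   Context: Simply typed $\lambda$-calculus over a single base type $0$; every type is uniquely $[A_1,\dots,A_n]:=A_1\to\cdots\to A_n\to0$. A context is a finite list of distinct typed variables; $\{\Gamma\}$ is its set of variables; for $\Gamma=x_1^{C_1},\dots,x_k^{C_k}$, $[\Gamma]:=[C_1,\dots,C_k]$. Terms are identified up to $\beta\eta$-conversion ($=_{\beta\eta}$). $\Lambda^\Xi(A)$ = terms of type $A$ with free variables in $\{\Xi\}$. A substitution $\varrho$ from $\Gamma$ to $\Delta$ assigns $\varrho_c\in\Lambda^\Delta(C)$ to each $c^C\in\{\Gamma\}$; for a context $\Xi$ of fresh variables, $\varrho^\Xi$ is the substitution from $\Xi,\Gamma$ to $\Xi,\Delta$ that is $\varrho$ on $\{\Gamma\}$ and the identity on $\{\Xi\}$, and $\hat\varrho^\Xi\colon\Lambda^{\Xi,\Gamma}(0)\to\Lambda^{\Xi,\Delta}(0)$, $M\mapsto M[\Gamma:=\varrho]$. A substitution $\varrho$ from $\Gamma$ to $\Delta$ is an atomic reduction if for every fresh context $\Xi$, all $a^A,b^B\in\{\Xi,\Gamma\}$ with $A\equiv[A_1,\dots,A_n]$, $B\equiv[B_1,\dots,B_m]$ and all $M_i\in\Lambda^{\Xi,\Delta}(A_i)$,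 $N_i\in\Lambda^{\Xi,\Delta}(B_i)$: $\varrho^\Xi_aM_1\cdots M_n=_{\beta\eta}\varrho^\Xi_bN_1\cdots N_m$ implies $a=b$ and $M_i=N_i$. It is a strong reduction if $\hat\varrho^\Xi$ is injective for every fresh context $\Xi$. For a pair (context–type) $\langle\Gamma_1|[\Delta_1]\rangle$, substitutions from $\langle\Gamma_1|[\Delta_1]\rangle$ to $\langle\Gamma_2|[\Delta_2]\rangle$ are substitutions from the context $\Gamma_1,\Delta_1$ to $\Gamma_2,\Delta_2$. We write $\langle\Gamma_1|[\Delta_1]\rangle\le^a\langle\Gamma_2|[\Delta_2]\rangle$ (resp. $\le^s$) if there is an atomic (resp. strong) reduction from $\Gamma_1,\Delta_1$ to $\Gamma_2,\Delta_2$. -}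

module Defs where

open import Data.List using (List; []; _∷_; _++_)
open import Data.List.Relation.Unary.All using (All; []; _∷_)
open import Data.Product using () renaming (Σ to Σ')

-- Simple types over the single base type 0 (written ι).
-- Every type is uniquely [A₁,…,Aₙ] = A₁ → ⋯ → Aₙ → ι (see `args`).
infixr 7 _⇒_
data Ty : Set where
  ι   : Ty
  _⇒_ : Ty → Ty → Ty

[_] : List Ty → Ty
[ [] ]     = ι
[ A ∷ As ] = A ⇒ [ As ]

args : Ty → List Ty
args ι       = []
args (A ⇒ B) = A ∷ args B

-- Contexts: lists of types; variables are typed de Bruijn indices
-- (so the variables of a context are automatically distinct).
Ctx : Set
Ctx = List Ty

infix 4 _∋_
data _∋_ : Ctx → Ty → Set where
  here  : ∀ {Γ A}   → (A ∷ Γ) ∋ A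
  there : ∀ {Γ A B} → Γ ∋ A → (B ∷ Γ) ∋ A

data Tm (Γ : Ctx) : Ty → Set where
  var : ∀ {A}   → Γ ∋ A → Tm Γ A
  lam : ∀ {A B} → Tm (A ∷ Γ) B → Tm Γ (A ⇒ B)
  app : ∀ {A B} → Tm Γ (A ⇒ B) → Tm Γ A → Tm Γ B

Ren : Ctx → Ctx → Set
Ren Γ Δ = ∀ {A} → Γ ∋ A → Δ ∋ A

Sub : Ctx → Ctx → Set
Sub Γ Δ = ∀ {A} → Γ ∋ A → Tm Δ A

liftRen : ∀ {Γ Δ B} → Ren Γ Δ → Ren (B ∷ Γ) (B ∷ Δ)
liftRen r here      = here
liftRen r (there x) = there (r x)

rename : ∀ {Γ Δ A} → Ren Γ Δ → Tm Γ A → Tm Δ A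
rename r (var x)   = var (r x)
rename r (lam M)   = lam (rename (liftRen r) M)
rename r (app M N) = app (rename r M) (rename r N)

weaken : ∀ {Γ A B} → Tm Γ A → Tm (B ∷ Γ) A
weaken = rename there

liftSub : ∀ {Γ Δ B} → Sub Γ Δ → Sub (B ∷ Γ) (B ∷ Δ)
liftSub σ here      = var here
liftSub σ (there x) = weaken (σ x)

subst : ∀ {Γ Δ A} → Sub Γ Δ → Tm Γ A → Tm Δ A
subst σ (var x)   = σ x
subst σ (lam M)   = lam (subst (liftSub σ) M)
subst σ (app M N) = app (subst σ M) (subst σ N)

single : ∀ {Γ A} → Tm Γ A → Sub (A ∷ Γ) Γ
single N here      = N
single N (there x) = var x

_[_]₀ : ∀ {Γ A B} → Tm (A ∷ Γ) B → Tm Γ A → Tm Γ B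
M [ N ]₀ = subst (single N) M

infix 4 _≈βη_
data _≈βη_ {Γ : Ctx} : ∀ {A} → Tm Γ A → Tm Γ A → Set where
  ≈refl  : ∀ {A} {M : Tm Γ A} → M ≈βη M
  ≈sym   : ∀ {A} {M N : Tm Γ A} → M ≈βη N → N ≈βη M
  ≈trans : ∀ {A} {M N P : Tm Γ A} → M ≈βη N → N ≈βη P → M ≈βη P
  ≈lam   : ∀ {A B} {M N : Tm (A ∷ Γ) B} → M ≈βη N → lam M ≈βη lam N
  ≈app   : ∀ {A B} {M M' : Tm Γ (A ⇒ B)} {N N' : Tm Γ A} →
           M ≈βη M' → N ≈βη N' → app M N ≈βη app M' N'
  ≈β     : ∀ {A B} (M : Tm (A ∷ Γ) B) (N : Tm Γ A) → app (lam M) N ≈βη M [ N ]₀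
  ≈η     : ∀ {A B} (M : Tm Γ (A ⇒ B)) → M ≈βη lam (app (weaken M) (var here))

Args : Ctx → Ty → Set
Args Γ A = All (Tm Γ) (args A)

spine : ∀ {Γ A} → Tm Γ A → Args Γ A → Tm Γ ι
spine {A = ι}     h []       = h
spine {A = A ⇒ B} h (M ∷ Ms) = spine (app h M) Ms

data ArgsEq {Γ : Ctx} : ∀ {As} → All (Tm Γ) As → All (Tm Γ) As → Set where
  []  : ArgsEq [] []
  _∷_ : ∀ {A As} {M N : Tm Γ A} {Ms Ns : All (Tm Γ) As} →
        M ≈βη N → ArgsEq Ms Ns → ArgsEq (M ∷ Ms) (N ∷ Ns)

data SameHead {Γ Θ : Ctx} : ∀ {A B} → Γ ∋ A → Args Θ A → Γ ∋ B → Args Θ B → Set where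
  same : ∀ {A} {a : Γ ∋ A} {Ms Ns : Args Θ A} → ArgsEq Ms Ns → SameHead a Ms a Ns

ext : ∀ {Γ Δ} (Ξ : Ctx) → Sub Γ Δ → Sub (Ξ ++ Γ) (Ξ ++ Δ)
ext []      ϱ = ϱ
ext (B ∷ Ξ) ϱ = liftSub (ext Ξ ϱ)

extHat : ∀ {Γ Δ} (Ξ : Ctx) → Sub Γ Δ → Tm (Ξ ++ Γ) ι → Tm (Ξ ++ Δ) ι
extHat Ξ ϱ M = subst (ext Ξ ϱ) M

IsAtomic : ∀ {Γ Δ} → Sub Γ Δ → Set
IsAtomic {Γ} {Δ} ϱ =
  ∀ (Ξ : Ctx) {A B} (a : (Ξ ++ Γ) ∋ A) (b : (Ξ ++ Γ) ∋ B)
    (Ms : Args (Ξ ++ Δ) A) (Ns : Args (Ξ ++ Δ) B) →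
    spine (ext Ξ ϱ a) Ms ≈βη spine (ext Ξ ϱ b) Ns →
    SameHead a Ms b Ns

IsStrong : ∀ {Γ Δ} → Sub Γ Δ → Set
IsStrong {Γ} {Δ} ϱ =
  ∀ (Ξ : Ctx) (M N : Tm (Ξ ++ Γ) ι) →
    extHat Ξ ϱ M ≈βη extHat Ξ ϱ N → M ≈βη N

record Pair : Set where
  constructor ⟨_∣_⟩
  field
    ctx  : Ctx
    tctx : Ctx   -- Δ, standing for the type [Δ]

open Pair public

_≤ᵃ_ : Pair → Pair → Set
P ≤ᵃ Q = Σ' (Sub (ctx P ++ tctx P) (ctx Q ++ tctx Q)) IsAtomic

_≤ˢ_ : Pair → Pair → Set
P ≤ˢ Q = Σ' (Sub (ctx P ++ tctx P) (ctx Q ++ tctx Q)) IsStrong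

-- Every term is βη-equal to a long normal form λ y⃗. x N₁ ⋯ Nₙ with the Nᵢ again long normal
-- forms, computed here by normalisation by evaluation. Applying ϱ^Ξ to such a term of type 0
-- gives ϱ^Ξ(x) applied to the ϱ^Ξ(Nᵢ), so atomicity turns ϱ̂^Ξ M = ϱ̂^Ξ N into equality of the
-- heads and of the ϱ^Ξ-images of the arguments; induction on long normal forms, with the
-- λ-bound variables y⃗ moved into Ξ, then gives M = N.
module Submission where

open import Defs
open import Data.List using (List; []; _∷_; _++_)
open import Data.List.Relation.Unary.All as All using (All; []; _∷_)
open import Data.Product using (_,_)
open import Relation.Binary.Bundles using (Setoid)
open import Relation.Binary.PropositionalEquality using (_≡_; refl; cong; cong₂; sym; trans)
import Relation.Binary.Reasoning.Setoid as SetoidReasoning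

private variable
  Γ Δ Θ : Ctx
  A B : Ty

rename-rename : (r : Ren Δ Θ) (r′ : Ren Γ Δ) {r″ : Ren Γ Θ} →
  (∀ {A} (x : Γ ∋ A) → r (r′ x) ≡ r″ x) → (t : Tm Γ A) → rename r (rename r′ t) ≡ rename r″ t
rename-rename r r′ h (var x)   = cong var (h x)
rename-rename r r′ h (lam t)   = cong lam (rename-rename (liftRen r) (liftRen r′) h′ t)
  where
  h′ : ∀ {A} (x : (B ∷ _) ∋ A) → liftRen r (liftRen r′ x) ≡ liftRen _ x
  h′ here      = refl
  h′ (there x) = cong there (h x)
rename-rename r r′ h (app t u) = cong₂ app (rename-rename r r′ h t) (rename-rename r r′ h u)

rename-weaken : (r : Ren Γ Δ) (t : Tm Γ A) → rename (liftRen {B = B} r) (weaken t) ≡ weaken (rename r t)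
rename-weaken r t = trans (rename-rename (liftRen r) there (λ _ → refl) t)
                          (sym (rename-rename there r (λ _ → refl) t))

rename-subst : (r : Ren Δ Θ) (σ : Sub Γ Δ) {σ′ : Sub Γ Θ} →
  (∀ {A} (x : Γ ∋ A) → rename r (σ x) ≡ σ′ x) → (t : Tm Γ A) → rename r (subst σ t) ≡ subst σ′ t
rename-subst r σ h (var x)   = h x
rename-subst r σ h (lam t)   = cong lam (rename-subst (liftRen r) (liftSub σ) h′ t)
  where
  h′ : ∀ {A} (x : (B ∷ _) ∋ A) → rename (liftRen r) (liftSub σ x) ≡ liftSub _ x
  h′ here      = refl
  h′ (there x) = trans (rename-weaken r (σ x)) (cong weaken (h x))
rename-subst r σ h (app t u) = cong₂ app (rename-subst r σ h t) (rename-subst r σ h u)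

subst-rename : (σ : Sub Δ Θ) (r : Ren Γ Δ) {σ′ : Sub Γ Θ} →
  (∀ {A} (x : Γ ∋ A) → σ (r x) ≡ σ′ x) → (t : Tm Γ A) → subst σ (rename r t) ≡ subst σ′ t
subst-rename σ r h (var x)   = h x
subst-rename σ r h (lam t)   = cong lam (subst-rename (liftSub σ) (liftRen r) h′ t)
  where
  h′ : ∀ {A} (x : (B ∷ _) ∋ A) → liftSub σ (liftRen r x) ≡ liftSub _ x
  h′ here      = refl
  h′ (there x) = cong weaken (h x)
subst-rename σ r h (app t u) = cong₂ app (subst-rename σ r h t) (subst-rename σ r h u)

subst-weaken : (σ : Sub Γ Δ) (t : Tm Γ A) → subst (liftSub {B = B} σ) (weaken t) ≡ weaken (subst σ t)
subst-weaken σ t = trans (subst-rename (liftSub σ) there (λ _ → refl) t)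
                         (sym (rename-subst there σ (λ _ → refl) t))

subst-subst : (σ : Sub Δ Θ) (τ : Sub Γ Δ) {σ′ : Sub Γ Θ} →
  (∀ {A} (x : Γ ∋ A) → subst σ (τ x) ≡ σ′ x) → (t : Tm Γ A) → subst σ (subst τ t) ≡ subst σ′ t
subst-subst σ τ h (var x)   = h x
subst-subst σ τ h (lam t)   = cong lam (subst-subst (liftSub σ) (liftSub τ) h′ t)
  where
  h′ : ∀ {A} (x : (B ∷ _) ∋ A) → subst (liftSub σ) (liftSub τ x) ≡ liftSub _ x
  h′ here      = refl
  h′ (there x) = trans (subst-weaken σ (τ x)) (cong weaken (h x))
subst-subst σ τ h (app t u) = cong₂ app (subst-subst σ τ h t) (subst-subst σ τ h u)

subst-id : (σ : Sub Γ Γ) → (∀ {A} (x : Γ ∋ A) → σ x ≡ var x) → (t : Tm Γ A) → subst σ t ≡ t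
subst-id σ h (var x)   = h x
subst-id σ h (lam t)   = cong lam (subst-id (liftSub σ) h′ t)
  where
  h′ : ∀ {A} (x : (B ∷ _) ∋ A) → liftSub σ x ≡ var x
  h′ here      = refl
  h′ (there x) = cong weaken (h x)
subst-id σ h (app t u) = cong₂ app (subst-id σ h t) (subst-id σ h u)

subst-var : (σ : Sub Γ Δ) (r : Ren Γ Δ) → (∀ {A} (x : Γ ∋ A) → σ x ≡ var (r x)) →
  (t : Tm Γ A) → subst σ t ≡ rename r t
subst-var σ r h (var x)   = h x
subst-var σ r h (lam t)   = cong lam (subst-var (liftSub σ) (liftRen r) h′ t)
  where
  h′ : ∀ {A} (x : (B ∷ _) ∋ A) → liftSub σ x ≡ var (liftRen r x)
  h′ here      = refl
  h′ (there x) = cong weaken (h x)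
subst-var σ r h (app t u) = cong₂ app (subst-var σ r h t) (subst-var σ r h u)

rename-id : (t : Tm Γ A) → rename (λ x → x) t ≡ t
rename-id t = trans (sym (subst-var var (λ x → x) (λ _ → refl) t)) (subst-id var (λ _ → refl) t)

_,s_ : Sub Γ Δ → Tm Δ A → Sub (A ∷ Γ) Δ
(σ ,s s) here      = s
(σ ,s s) (there x) = σ x

subst-single-weaken : (N : Tm Γ B) (t : Tm Γ A) → weaken t [ N ]₀ ≡ t
subst-single-weaken N t = trans (subst-rename (single N) there (λ _ → refl) t) (subst-id var (λ _ → refl) t)

subst-[]₀ : (σ : Sub Γ Δ) (M : Tm (B ∷ Γ) A) (N : Tm Γ B) →
  subst σ (M [ N ]₀) ≡ subst (liftSub σ) M [ subst σ N ]₀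
subst-[]₀ σ M N = trans (subst-subst σ (single N) h M) (sym (subst-subst (single (subst σ N)) (liftSub σ) h′ M))
  where
  h : ∀ {A} (x : (_ ∷ _) ∋ A) → subst σ (single N x) ≡ (σ ,s subst σ N) x
  h here      = refl
  h (there x) = refl
  h′ : ∀ {A} (x : (_ ∷ _) ∋ A) → liftSub σ x [ subst σ N ]₀ ≡ (σ ,s subst σ N) x
  h′ here      = refl
  h′ (there x) = subst-single-weaken (subst σ N) (σ x)

lift-weaken-[here]₀ : (M : Tm (B ∷ Γ) A) → rename (liftRen there) M [ var here ]₀ ≡ M
lift-weaken-[here]₀ M = trans (subst-rename (single (var here)) (liftRen there) h M) (subst-id var (λ _ → refl) M)
  where
  h : ∀ {A} (x : (_ ∷ _) ∋ A) → single (var here) (liftRen there x) ≡ var x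
  h here      = refl
  h (there x) = refl

βη-setoid : Ctx → Ty → Setoid _ _
βη-setoid Γ A = record
  { Carrier       = Tm Γ A
  ; _≈_           = _≈βη_
  ; isEquivalence = record { refl = ≈refl ; sym = ≈sym ; trans = ≈trans }
  }

module βη-Reasoning {Γ : Ctx} {A : Ty} = SetoidReasoning (βη-setoid Γ A)

≡⇒≈βη : {M N : Tm Γ A} → M ≡ N → M ≈βη N
≡⇒≈βη refl = ≈refl

subst-≈βη : (σ : Sub Γ Δ) {M N : Tm Γ A} → M ≈βη N → subst σ M ≈βη subst σ N
subst-≈βη σ ≈refl          = ≈refl
subst-≈βη σ (≈sym e)       = ≈sym (subst-≈βη σ e)
subst-≈βη σ (≈trans e e′)  = ≈trans (subst-≈βη σ e) (subst-≈βη σ e′)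
subst-≈βη σ (≈lam e)       = ≈lam (subst-≈βη (liftSub σ) e)
subst-≈βη σ (≈app e e′)    = ≈app (subst-≈βη σ e) (subst-≈βη σ e′)
subst-≈βη σ (≈β M N)       = ≈trans (≈β _ _) (≡⇒≈βη (sym (subst-[]₀ σ M N)))
subst-≈βη σ (≈η M)         = ≈trans (≈η (subst σ M))
  (≡⇒≈βη (cong (λ M′ → lam (app M′ (var here))) (sym (subst-weaken σ M))))

rename-≈βη : (r : Ren Γ Δ) {M N : Tm Γ A} → M ≈βη N → rename r M ≈βη rename r N
rename-≈βη r {M} {N} e = begin
    rename r M        ≡⟨ subst-var _ r (λ _ → refl) M ⟨
    subst (var∘r) M   ≈⟨ subst-≈βη var∘r e ⟩
    subst (var∘r) N   ≡⟨ subst-var _ r (λ _ → refl) N ⟩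
    rename r N        ∎
  where
  open βη-Reasoning
  var∘r : Sub _ _
  var∘r x = var (r x)

lam-injective : {P Q : Tm (A ∷ Γ) B} → lam P ≈βη lam Q → P ≈βη Q
lam-injective {P = P} {Q} e = begin
    P                                        ≡⟨ lift-weaken-[here]₀ P ⟨
    rename (liftRen there) P [ var here ]₀   ≈⟨ ≈β _ _ ⟨
    app (weaken (lam P)) (var here)          ≈⟨ ≈app (rename-≈βη there e) ≈refl ⟩
    app (weaken (lam Q)) (var here)          ≈⟨ ≈β _ _ ⟩
    rename (liftRen there) Q [ var here ]₀   ≡⟨ lift-weaken-[here]₀ Q ⟩
    Q                                        ∎
  where open βη-Reasoning

-- Normalisation by evaluation

mutual
  data Ne (Γ : Ctx) : Ty → Set where
    nvar : Γ ∋ A → Ne Γ A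
    napp : Ne Γ (A ⇒ B) → Nf Γ A → Ne Γ B

  data Nf (Γ : Ctx) : Ty → Set where
    nne  : Ne Γ ι → Nf Γ ι
    nlam : Nf (A ∷ Γ) B → Nf Γ (A ⇒ B)

mutual
  renameNe : Ren Γ Δ → Ne Γ A → Ne Δ A
  renameNe r (nvar x)   = nvar (r x)
  renameNe r (napp n u) = napp (renameNe r n) (renameNf r u)

  renameNf : Ren Γ Δ → Nf Γ A → Nf Δ A
  renameNf r (nne n)  = nne (renameNe r n)
  renameNf r (nlam u) = nlam (renameNf (liftRen r) u)

mutual
  embNe : Ne Γ A → Tm Γ A
  embNe (nvar x)   = var x
  embNe (napp n u) = app (embNe n) (embNf u)

  embNf : Nf Γ A → Tm Γ A
  embNf (nne n)  = embNe n
  embNf (nlam u) = lam (embNf u)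

mutual
  rename-embNe : (r : Ren Γ Δ) (n : Ne Γ A) → rename r (embNe n) ≡ embNe (renameNe r n)
  rename-embNe r (nvar x)   = refl
  rename-embNe r (napp n u) = cong₂ app (rename-embNe r n) (rename-embNf r u)

  rename-embNf : (r : Ren Γ Δ) (u : Nf Γ A) → rename r (embNf u) ≡ embNf (renameNf r u)
  rename-embNf r (nne n)  = rename-embNe r n
  rename-embNf r (nlam u) = cong lam (rename-embNf (liftRen r) u)

Sem : Ty → Ctx → Set
Sem ι       Γ = Nf Γ ι
Sem (A ⇒ B) Γ = ∀ {Δ} → Ren Γ Δ → Sem A Δ → Sem B Δ

renameSem : ∀ A → Ren Γ Δ → Sem A Γ → Sem A Δ
renameSem ι       r v = renameNf r v
renameSem (A ⇒ B) r f = λ r′ v → f (λ x → r′ (r x)) v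

mutual
  reflect : ∀ A → Ne Γ A → Sem A Γ
  reflect ι       n = nne n
  reflect (A ⇒ B) n = λ r v → reflect B (napp (renameNe r n) (reify A v))

  reify : ∀ A → Sem A Γ → Nf Γ A
  reify ι       v = v
  reify (A ⇒ B) f = nlam (reify B (f there (reflect A (nvar here))))

Env : Ctx → Ctx → Set
Env Γ Δ = ∀ {A} → Γ ∋ A → Sem A Δ

_,e_ : Env Γ Δ → Sem A Δ → Env (A ∷ Γ) Δ
(ρ ,e v) here      = v
(ρ ,e v) (there x) = ρ x

eval : Env Γ Δ → Tm Γ A → Sem A Δ
eval ρ (var x)   = ρ x
eval ρ (lam t)   = λ r v → eval ((λ {B} x → renameSem B r (ρ x)) ,e v) t
eval ρ (app t u) = eval ρ t (λ x → x) (eval ρ u)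

nf : Tm Γ A → Nf Γ A
nf {A = A} t = reify A (eval (λ {B} x → reflect B (nvar x)) t)

R⟦_⟧ : ∀ A {Γ} → Tm Γ A → Sem A Γ → Set
R⟦ ι     ⟧     t v = t ≈βη embNf v
R⟦ A ⇒ B ⟧ {Γ} t f = ∀ {Δ} (r : Ren Γ Δ) {s : Tm Δ A} {v : Sem A Δ} →
  R⟦ A ⟧ s v → R⟦ B ⟧ (app (rename r t) s) (f r v)

R-≈βη : ∀ A {t t′ : Tm Γ A} {v} → t ≈βη t′ → R⟦ A ⟧ t v → R⟦ A ⟧ t′ v
R-≈βη ι       e h      = ≈trans (≈sym e) h
R-≈βη (A ⇒ B) e h r hs = R-≈βη B (≈app (rename-≈βη r e) ≈refl) (h r hs)

R-rename : ∀ A (r : Ren Γ Δ) {t : Tm Γ A} {v} → R⟦ A ⟧ t v → R⟦ A ⟧ (rename r t) (renameSem A r v)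
R-rename ι       r {v = v} h = ≈trans (rename-≈βη r h) (≡⇒≈βη (rename-embNf r v))
R-rename (A ⇒ B) r {t} h r′ hs =
  R-≈βη B (≈app (≡⇒≈βη (sym (rename-rename r′ r (λ _ → refl) t))) ≈refl) (h (λ x → r′ (r x)) hs)

mutual
  reflect-R : ∀ A (n : Ne Γ A) → R⟦ A ⟧ (embNe n) (reflect A n)
  reflect-R ι       n      = ≈refl
  reflect-R (A ⇒ B) n r hs =
    R-≈βη B (≈app (≡⇒≈βη (sym (rename-embNe r n))) (≈sym (reify-R A hs)))
      (reflect-R B (napp (renameNe r n) (reify A _)))

  reify-R : ∀ A {t : Tm Γ A} {v} → R⟦ A ⟧ t v → t ≈βη embNf (reify A v)
  reify-R ι       h     = h
  reify-R (A ⇒ B) {t} h = ≈trans (≈η t) (≈lam (reify-R B (h there (reflect-R A (nvar here)))))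

fundamental : (σ : Sub Γ Δ) (ρ : Env Γ Δ) → (∀ {A} (x : Γ ∋ A) → R⟦ A ⟧ (σ x) (ρ x)) →
  (t : Tm Γ A) → R⟦ A ⟧ (subst σ t) (eval ρ t)
fundamental σ ρ hρ (var x) = hρ x
fundamental σ ρ hρ (app {B = B} t u) =
  R-≈βη B (≈app (≡⇒≈βη (rename-id (subst σ t))) ≈refl) (fundamental σ ρ hρ t (λ x → x) (fundamental σ ρ hρ u))
fundamental {Γ} σ ρ hρ (lam {A} {B} t) {Θ} r {s} {v} hs =
  R-≈βη B (≈sym (≈trans (≈β _ _) (≡⇒≈βη β-reduct))) (fundamental σ′ ρ′ hρ′ t)
  where
  σ′ : Sub (A ∷ Γ) Θ
  σ′ = (λ x → rename r (σ x)) ,s s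
  ρ′ : Env (A ∷ Γ) Θ
  ρ′ = (λ {C} x → renameSem C r (ρ x)) ,e v
  hρ′ : ∀ {C} (x : (A ∷ Γ) ∋ C) → R⟦ C ⟧ (σ′ x) (ρ′ x)
  hρ′ here          = hs
  hρ′ {C} (there x) = R-rename C r (hρ x)
  lift-σ′ : ∀ {C} (x : (A ∷ Γ) ∋ C) → rename (liftRen r) (liftSub σ x) [ s ]₀ ≡ σ′ x
  lift-σ′ here      = refl
  lift-σ′ (there x) = trans (cong (_[ s ]₀) (rename-weaken r (σ x))) (subst-single-weaken s (rename r (σ x)))
  β-reduct : rename (liftRen r) (subst (liftSub σ) t) [ s ]₀ ≡ subst σ′ t
  β-reduct = trans (cong (_[ s ]₀) (rename-subst (liftRen r) (liftSub σ) (λ _ → refl) t))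
                   (subst-subst (single s) _ lift-σ′ t)

nf-sound : (t : Tm Γ A) → t ≈βη embNf (nf t)
nf-sound {A = A} t = ≈trans (≡⇒≈βη (sym (subst-id var (λ _ → refl) t)))
  (reify-R A (fundamental var (λ {B} x → reflect B (nvar x)) (λ {B} x → reflect-R B (nvar x)) t))

-- Long normal forms in spine form

mutual
  data SNf (Γ : Ctx) : Ty → Set where
    slam : SNf (A ∷ Γ) B → SNf Γ (A ⇒ B)
    sne  : Γ ∋ A → SArgs Γ (args A) → SNf Γ ι

  data SArgs (Γ : Ctx) : List Ty → Set where
    []  : SArgs Γ []
    _∷_ : ∀ {As} → SNf Γ A → SArgs Γ As → SArgs Γ (A ∷ As)

mutual
  embS : SNf Γ A → Tm Γ A
  embS (slam t)    = lam (embS t)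
  embS (sne x Ms)  = spine (var x) (embSArgs Ms)

  embSArgs : ∀ {As} → SArgs Γ As → All (Tm Γ) As
  embSArgs []       = []
  embSArgs (M ∷ Ms) = embS M ∷ embSArgs Ms

mutual
  toSNf : Nf Γ A → SNf Γ A
  toSNf (nne n)  = toSNe n []
  toSNf (nlam u) = slam (toSNf u)

  toSNe : Ne Γ A → SArgs Γ (args A) → SNf Γ ι
  toSNe (nvar x)   Ms = sne x Ms
  toSNe (napp n u) Ms = toSNe n (toSNf u ∷ Ms)

mutual
  embS-toSNf : (u : Nf Γ A) → embS (toSNf u) ≡ embNf u
  embS-toSNf (nne n)  = embS-toSNe n []
  embS-toSNf (nlam u) = cong lam (embS-toSNf u)

  embS-toSNe : (n : Ne Γ A) (Ms : SArgs Γ (args A)) → embS (toSNe n Ms) ≡ spine (embNe n) (embSArgs Ms)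
  embS-toSNe (nvar x)   Ms = refl
  embS-toSNe (napp n u) Ms = trans (embS-toSNe n (toSNf u ∷ Ms))
                                   (cong (λ U → spine (app (embNe n) U) (embSArgs Ms)) (embS-toSNf u))

snf : Tm Γ A → SNf Γ A
snf t = toSNf (nf t)

snf-sound : (t : Tm Γ A) → t ≈βη embS (snf t)
snf-sound t = ≈trans (nf-sound t) (≡⇒≈βη (sym (embS-toSNf (nf t))))

subst-spine : ∀ A (σ : Sub Γ Δ) (h : Tm Γ A) (Ms : Args Γ A) →
  subst σ (spine h Ms) ≡ spine (subst σ h) (All.map (subst σ) Ms)
subst-spine ι       σ h []       = refl
subst-spine (A ⇒ B) σ h (M ∷ Ms) = subst-spine B σ (app h M) Ms

subst-spines-≈βη : (σ : Sub Γ Δ) (x : Γ ∋ A) (y : Γ ∋ B) (Ms : Args Γ A) (Ns : Args Γ B) →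
  subst σ (spine (var x) Ms) ≈βη subst σ (spine (var y) Ns) →
  spine (σ x) (All.map (subst σ) Ms) ≈βη spine (σ y) (All.map (subst σ) Ns)
subst-spines-≈βη {A = A} {B = B} σ x y Ms Ns e =
  ≈trans (≡⇒≈βη (sym (subst-spine A σ (var x) Ms))) (≈trans e (≡⇒≈βη (subst-spine B σ (var y) Ns)))

spine-≈βη : ∀ A {h h′ : Tm Γ A} {Ms Ns : Args Γ A} → h ≈βη h′ → ArgsEq Ms Ns → spine h Ms ≈βη spine h′ Ns
spine-≈βη ι       e []         = e
spine-≈βη (A ⇒ B) e (e′ ∷ es)  = spine-≈βη B (≈app e e′) es

module _ {Γ Δ : Ctx} {ϱ : Sub Γ Δ} (atomic : IsAtomic ϱ) where

  mutual
    atomic-injectiveS : ∀ Ξ {A} (M N : SNf (Ξ ++ Γ) A) →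
      subst (ext Ξ ϱ) (embS M) ≈βη subst (ext Ξ ϱ) (embS N) → embS M ≈βη embS N
    atomic-injectiveS Ξ (slam {A} M) (slam N) e = ≈lam (atomic-injectiveS (A ∷ Ξ) M N (lam-injective e))
    atomic-injectiveS Ξ (sne {A} x Ms) (sne {B} y Ns) e
      with atomic Ξ x y _ _ (subst-spines-≈βη (ext Ξ ϱ) x y _ _ e)
    ... | same es = spine-≈βη A ≈refl (atomic-injectiveSArgs Ξ Ms Ns es)

    atomic-injectiveSArgs : ∀ Ξ {As} (Ms Ns : SArgs (Ξ ++ Γ) As) →
      ArgsEq (All.map (subst (ext Ξ ϱ)) (embSArgs Ms)) (All.map (subst (ext Ξ ϱ)) (embSArgs Ns)) →
      ArgsEq (embSArgs Ms) (embSArgs Ns)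
    atomic-injectiveSArgs Ξ []       []       []       = []
    atomic-injectiveSArgs Ξ (M ∷ Ms) (N ∷ Ns) (e ∷ es) =
      atomic-injectiveS Ξ M N e ∷ atomic-injectiveSArgs Ξ Ms Ns es

  atomic⇒strong : IsStrong ϱ
  atomic⇒strong Ξ M N e = begin
      M                  ≈⟨ snf-sound M ⟩
      embS (snf M)       ≈⟨ atomic-injectiveS Ξ (snf M) (snf N) ϱ-snf ⟩
      embS (snf N)       ≈⟨ snf-sound N ⟨
      N                  ∎
    where
    open βη-Reasoning
    ϱ-snf : extHat Ξ ϱ (embS (snf M)) ≈βη extHat Ξ ϱ (embS (snf N))
    ϱ-snf = begin
      extHat Ξ ϱ (embS (snf M))   ≈⟨ subst-≈βη (ext Ξ ϱ) (snf-sound M) ⟨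
      extHat Ξ ϱ M                ≈⟨ e ⟩
      extHat Ξ ϱ N                ≈⟨ subst-≈βη (ext Ξ ϱ) (snf-sound N) ⟩
      extHat Ξ ϱ (embS (snf N))   ∎

propositionP : (Γ₁ Δ₁ Γ₂ Δ₂ : Ctx) → ⟨ Γ₁ ∣ Δ₁ ⟩ ≤ᵃ ⟨ Γ₂ ∣ Δ₂ ⟩ → ⟨ Γ₁ ∣ Δ₁ ⟩ ≤ˢ ⟨ Γ₂ ∣ Δ₂ ⟩
propositionP Γ₁ Δ₁ Γ₂ Δ₂ (ϱ , atomic) = ϱ , atomic⇒strong atomic
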